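{- For every $n\ge 1$, $F_n(x)=P_n(x)$, where \[ F_n(x)=\sum_{w\in L(F_n)}\ \sum_{\sigma\in\mathcal{L}(F_n,w)}x^{\mathrm{des}_B(\sigma)} \qquad\text{and}\qquad P_n(x)=\sum_{\sigma\in P_n}x^{\mathrm{des}_B(\sigma)}. \]
   Context: A signed permutation on a multiset $M$ of positive integers is a word $\sigma=\sigma_1\cdots\sigma_m$ obtained by arranging the elements of $M$ in some order and possibly negating each letter. Letters are compared as integers. $P_n$ is the set of signed permutations on $\{1^2,2^2,\ldots,n^2\}$. Define $\mathrm{Des}_B(\sigma)=\{i:1\le i\le m-1,\ \sigma_i>\sigma_{i+1}\}\cup\{m \text{ if } \sigma_m>0\}$ and $\mathrm{des}_B(\sigma)=|\mathrm{Des}_B(\sigma)|$. Let $F_n$ be the forest consisting of $n$ trees $T_1,\ldots,T_n$. Each $T_i$ has exactly two vertices: a root $u_i$ and its child $v_i$. The forest is partially ordered by $x<_F y$ iff $y$ is a proper ancestor of $x$; thus $v_i<_F u_i$. A linear extension of $F_n$ is an ordering $x_{1}x_{2}\cdots x_{2n}$ of all vertices such that $x_j<_F x_k$ implies $j<k$. A signed labeling $w$ assigns to each vertex a nonzero integer, where the absolute values form a set of distinct positive integers. $\mathcal{L}(F_n,w)$ is the set of words $w(x_{1})\cdots w(x_{2n})$ obtained from the linear extensions $x_1\cdots x_{2n}$ of $F_n$. $L(F_n)$ is the set of signed labelings $w$ of $F_n$ such that, for each $i$, the pair $(w(u_i),w(v_i))$ is one of $(2i,2i-1)$, $(2i,-(2i-1))$,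 $(-2i,2i-1)$, $(-(2i-1),-2i)$. -}

module Defs where

open import Data.Bool using (Bool; true; false; _∧_; not; if_then_else_)
open import Data.Nat using (ℕ; zero; suc; _*_; _+_; _≡ᵇ_; _<ᵇ_)
open import Data.Integer as ℤ using (ℤ; +_; -_; ∣_∣)
open import Data.Fin as Fin using (Fin; toℕ)
open import Data.List using (List; []; _∷_; map; concatMap; filterᵇ; length; upTo; allFin; _++_; deduplicate)
open import Data.List.Properties using (≡-dec)
open import Data.Nat.ListAction using (sum)
open import Data.Bool.ListAction using (all)
open import Data.Vec as Vec using (Vec; lookup)
open import Relation.Nullary.Decidable using (⌊_⌋)

words : {A : Set} → List A → ℕ → List (List A)
words xs zero    = [] ∷ []
words xs (suc m) = concatMap (λ x → map (x ∷_) (words xs m)) xs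

vecs : {A : Set} → List A → (n : ℕ) → List (Vec A n)
vecs xs zero    = Vec.[] ∷ []
vecs xs (suc n) = concatMap (λ x → map (x Vec.∷_) (vecs xs n)) xs

countᵇ : {A : Set} → (A → Bool) → List A → ℕ
countᵇ p xs = length (filterᵇ p xs)

desB : List ℤ → ℕ
desB []            = 0
desB (x ∷ [])      = if ⌊ + 0 ℤ.<? x ⌋ then 1 else 0
desB (x ∷ y ∷ r)   = (if ⌊ y ℤ.<? x ⌋ then 1 else 0) + desB (y ∷ r)

signedAlphabet : ℕ → List ℤ
signedAlphabet n = concatMap (λ i → + suc i ∷ - (+ suc i) ∷ []) (upTo n)

-- a word of length 2n over ±1..±n is a signed permutation of {1^2,...,n^2}
-- iff each absolute value i ∈ {1..n} occurs exactly twice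
isSignedPerm : ℕ → List ℤ → Bool
isSignedPerm n σ = all (λ i → countᵇ (λ x → ∣ x ∣ ≡ᵇ suc i) σ ≡ᵇ 2) (upTo n)

Pset : ℕ → List (List ℤ)
Pset n = filterᵇ (isSignedPerm n) (words (signedAlphabet n) (2 * n))

Pcoeff : ℕ → ℕ → ℕ
Pcoeff n k = countᵇ (λ σ → desB σ ≡ᵇ k) (Pset n)

-- The forest F_n : trees T_i with root u_i and child v_i (i ∈ Fin n,
-- i.e. index i here stands for the tree T_{i+1})

data Vtx (n : ℕ) : Set where
  u : Fin n → Vtx n
  v : Fin n → Vtx n

allVtx : (n : ℕ) → List (Vtx n)
allVtx n = map u (allFin n) ++ map v (allFin n)

_==V_ : {n : ℕ} → Vtx n → Vtx n → Bool
u i ==V u j = ⌊ i Fin.≟ j ⌋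
v i ==V v j = ⌊ i Fin.≟ j ⌋
_   ==V _   = false

-- x <_F y  iff  y is a proper ancestor of x  (only v_i <_F u_i)
_<F_ : {n : ℕ} → Vtx n → Vtx n → Bool
v i <F u j = ⌊ i Fin.≟ j ⌋
_   <F _   = false

isArrangement : {n : ℕ} → List (Vtx n) → Bool
isArrangement {n} xs = all (λ y → countᵇ (y ==V_) xs ≡ᵇ 1) (allVtx n)

respectsF : {n : ℕ} → List (Vtx n) → Bool
respectsF []       = true
respectsF (x ∷ xs) = all (λ y → not (y <F x)) xs ∧ respectsF xs

linExts : (n : ℕ) → List (List (Vtx n))
linExts n = filterᵇ (λ xs → isArrangement xs ∧ respectsF xs)
                    (words (allVtx n) (2 * n))

-- The labelings L(F_n): for each i, (w(u_i), w(v_i)) is one of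
--   c1 : (2i, 2i-1)      c2 : (2i, -(2i-1))
--   c3 : (-2i, 2i-1)     c4 : (-(2i-1), -2i)

data Choice : Set where
  c1 c2 c3 c4 : Choice

allChoices : List Choice
allChoices = c1 ∷ c2 ∷ c3 ∷ c4 ∷ []

Labeling : ℕ → Set
Labeling n = Vec Choice n

labelings : (n : ℕ) → List (Labeling n)
labelings n = vecs allChoices n

-- the value of the labeling at a vertex (tree index i ↦ i' = toℕ i + 1)
label : {n : ℕ} → Labeling n → Vtx n → ℤ
label w (u i) with lookup w i
... | c1 = + (2 * suc (toℕ i))
... | c2 = + (2 * suc (toℕ i))
... | c3 = - (+ (2 * suc (toℕ i)))
... | c4 = - (+ (2 * suc (toℕ i) Data.Nat.∸ 1))
label w (v i) with lookup w i
... | c1 = + (2 * suc (toℕ i) Data.Nat.∸ 1)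
... | c2 = - (+ (2 * suc (toℕ i) Data.Nat.∸ 1))
... | c3 = + (2 * suc (toℕ i) Data.Nat.∸ 1)
... | c4 = - (+ (2 * suc (toℕ i)))

-- 𝓛(F_n, w) : the SET of words w(x_1)…w(x_2n) over linear extensions
Lset : (n : ℕ) → Labeling n → List (List ℤ)
Lset n w = deduplicate (≡-dec ℤ._≟_) (map (map (label w)) (linExts n))

Fcoeff : ℕ → ℕ → ℕ
Fcoeff n k = sum (map (λ w → countᵇ (λ σ → desB σ ≡ᵇ k) (Lset n w)) (labelings n))

-- Replacing each label ±2i, ±(2i−1) by ±i ("collapsing") turns a labelled linear extension of F_n
-- into a signed permutation of {1²,…,n²}. Collapsing is monotone, so it keeps every descent except
-- those between two labels that collapse to the same letter; the four admissible labelings of T_i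
-- are exactly those for which such a pair can only be u_i followed by v_i, which a linear extension
-- never contains. Conversely, a signed permutation determines the linear extension (the first copy
-- of i is v_i, the second u_i) and the labeling (the signs of those two copies), so collapsing is a
-- bijection from pairs (labeling, linear extension) onto P_n that preserves des_B.

module Submission where

open import Defs
open import Data.Bool using (Bool; true; false; T; not; _∧_; if_then_else_)
open import Data.Bool.Properties using (T-∧)
open import Data.Nat as ℕ using (ℕ; zero; suc; _+_; _*_; _∸_; _≤_; z<s; s≤s⁻¹; ⌊_/2⌋; ⌈_/2⌉)
open import Data.Nat.ListAction using (sum)
open import Data.Nat.Properties
  using (≤-refl; ≤-reflexive; ≤-trans; n≤1+n; n<1+n; n≤0⇒n≡0; ≡ᵇ⇒≡; ≡⇒≡ᵇ; +-suc; +-identityʳ; +-cancelˡ-≡;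
         m+n≡0⇒m≡0; ⌊n/2⌋-mono; ⌈n/2⌉-mono; n≡⌊n+n/2⌋; n≡⌈n+n/2⌉)
open import Data.Integer as ℤ using (ℤ; +_; -[1+_]; -_; ∣_∣; +≤+; -≤+; -≤-; +<+)
open import Data.Integer.Properties using (<⇒≤; ≤∧≢⇒<; <⇒≱; ≰⇒>; <-irrefl; <-asym; neg-mono-<)
open import Data.Fin as Fin using (Fin; toℕ)
open import Data.Fin.Properties using (toℕ-injective; toℕ<n; toℕ-fromℕ<)
open import Data.List
  using (List; []; _∷_; map; filterᵇ; length; _++_; concatMap; allFin; upTo;
         cartesianProductWith; cartesianProduct; deduplicate)
open import Data.List.Properties
  using (≡-dec; length-++; length-map; filter-++; filter-all; filter-none; filter-accept; filter-reject;
         map-cong; map-cong-local; map-∘; map-injective; concatMap-cong; map-concatMap; ∷-injective)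
open import Data.List.Membership.Propositional using (_∈_; _∉_)
open import Data.List.Membership.Propositional.Properties
  using (∈-map⁺; ∈-map⁻; ∈-filter⁺; ∈-filter⁻; ∈-++⁺ˡ; ∈-++⁺ʳ; ∈-allFin; ∈-upTo⁺; ∈-upTo⁻;
         ∈-cartesianProductWith⁺; ∈-cartesianProductWith⁻; ∈-cartesianProduct⁺; ∈-cartesianProduct⁻)
open import Data.List.Membership.Propositional.Properties.WithK using (unique∧set⇒bag)
open import Data.List.Relation.Unary.Any using (here; there)
open import Data.List.Relation.Unary.All as All using (All; []; _∷_)
open import Data.List.Relation.Unary.All.Properties as All using (all⁺; all⁻)
open import Data.List.Relation.Unary.AllPairs using (AllPairs; []; _∷_)
open import Data.List.Relation.Unary.Linked as Linked using (Linked; []; [-]; _∷_)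
open import Data.List.Relation.Unary.Linked.Properties as Linked using (AllPairs⇒Linked)
open import Data.List.Relation.Unary.Unique.Propositional using (Unique)
import Data.List.Relation.Unary.Unique.Propositional.Properties as Unique
open import Data.List.Relation.Binary.Permutation.Propositional using (_↭_)
open import Data.List.Relation.Binary.Permutation.Propositional.Properties using (↭-length; filter-↭)
open import Data.List.Relation.Binary.BagAndSetEquality using (∼bag⇒↭)
open import Data.Vec as Vec using (Vec; lookup; tabulate)
open import Data.Vec.Properties as Vecₚ using (lookup∘tabulate; tabulate∘lookup; tabulate-cong)
open import Data.Product using (_×_; _,_; proj₁; proj₂; ∃; swap)
open import Data.Empty using (⊥-elim)
open import Function using (_∘_; id; case_of_)
open import Function.Bundles using (_⇔_; mk⇔; Equivalence)
open import Relation.Binary.Core using (_Preserves_⟶_)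
open import Relation.Binary.Definitions using (DecidableEquality)
open import Relation.Binary.PropositionalEquality
open import Relation.Nullary using (¬_; yes; no; does; contradiction)
open import Relation.Nullary.Decidable using (Dec; ⌊_⌋; T?; ¬?; fromWitness; toWitness; does-⇔; isYes≗does)

private variable
  A B C : Set


T-not : ∀ {b} → T (not b) ⇔ (¬ T b)
T-not {true}  = mk⇔ (λ ()) (λ ¬t → ¬t _)
T-not {false} = mk⇔ (λ _ ()) (λ _ → _)


countᵇ-↭ : (p : A → Bool) {xs ys : List A} → xs ↭ ys → countᵇ p xs ≡ countᵇ p ys
countᵇ-↭ p xs↭ys = ↭-length (filter-↭ (T? ∘ p) xs↭ys)

countᵇ-++ : (p : A → Bool) (xs ys : List A) → countᵇ p (xs ++ ys) ≡ countᵇ p xs + countᵇ p ys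
countᵇ-++ p xs ys = trans (cong length (filter-++ (T? ∘ p) xs ys)) (length-++ (filterᵇ p xs))

countᵇ-map : (p : B → Bool) (f : A → B) (xs : List A) → countᵇ p (map f xs) ≡ countᵇ (p ∘ f) xs
countᵇ-map p f []       = refl
countᵇ-map p f (x ∷ xs) with p (f x)
... | true  = cong suc (countᵇ-map p f xs)
... | false = countᵇ-map p f xs

countᵇ-cong-local : {p q : A → Bool} {xs : List A} → All (λ x → p x ≡ q x) xs → countᵇ p xs ≡ countᵇ q xs
countᵇ-cong-local {p = p} {q} {xs} p≗q = begin
  countᵇ p xs              ≡⟨ countᵇ-map id p xs ⟨
  countᵇ id (map p xs)     ≡⟨ cong (countᵇ id) (map-cong-local p≗q) ⟩
  countᵇ id (map q xs)     ≡⟨ countᵇ-map id q xs ⟩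
  countᵇ q xs              ∎
  where open ≡-Reasoning

sum-countᵇ-concatMap : (p : B → Bool) (f : A → List B) (xs : List A) →
  sum (map (countᵇ p ∘ f) xs) ≡ countᵇ p (concatMap f xs)
sum-countᵇ-concatMap p f []       = refl
sum-countᵇ-concatMap p f (x ∷ xs) =
  trans (cong (λ c → countᵇ p (f x) + c) (sum-countᵇ-concatMap p f xs)) (sym (countᵇ-++ p (f x) (concatMap f xs)))

countᵇ-accept : (p : A → Bool) {x : A} {xs : List A} → T (p x) → countᵇ p (x ∷ xs) ≡ suc (countᵇ p xs)
countᵇ-accept p px = cong length (filter-accept (T? ∘ p) px)

countᵇ-reject : (p : A → Bool) {x : A} {xs : List A} → ¬ T (p x) → countᵇ p (x ∷ xs) ≡ countᵇ p xs
countᵇ-reject p ¬px = cong length (filter-reject (T? ∘ p) ¬px)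

countᵇ-∷-≤ : (p : A → Bool) (x : A) (xs : List A) → countᵇ p xs ≤ countᵇ p (x ∷ xs)
countᵇ-∷-≤ p x xs with p x
... | true  = n≤1+n _
... | false = ≤-refl

countᵇ-∈ : (p : A → Bool) {x : A} {xs : List A} → x ∈ xs → T (p x) → countᵇ p xs ≢ 0
countᵇ-∈ p x∈xs px = nonEmpty (∈-filter⁺ (T? ∘ p) x∈xs px)
  where
  nonEmpty : ∀ {x : A} {ys} → x ∈ ys → length ys ≢ 0
  nonEmpty (here _)  ()
  nonEmpty (there _) ()

module _ {_==_ : A → A → Bool} (==⇒≡ : ∀ {x y} → T (x == y) → x ≡ y) (==-refl : ∀ x → T (x == x)) where

  countᵇ-∉ : {y : A} {xs : List A} → y ∉ xs → countᵇ (y ==_) xs ≡ 0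
  countᵇ-∉ {y} {xs} y∉xs = cong length (filter-none (T? ∘ (y ==_))
    (All.tabulate λ x∈xs y==x → y∉xs (subst (_∈ xs) (sym (==⇒≡ y==x)) x∈xs)))

  ∈-countᵇ : {y : A} (xs : List A) → countᵇ (y ==_) xs ≢ 0 → y ∈ xs
  ∈-countᵇ []       c≢0 = contradiction refl c≢0
  ∈-countᵇ {y} (x ∷ xs) c≢0 with y == x in y==x
  ... | true  = here (==⇒≡ (subst T (sym y==x) _))
  ... | false = there (∈-countᵇ xs c≢0)

  countᵇ≤1⇒Unique : {xs : List A} → (∀ y → countᵇ (y ==_) xs ≤ 1) → Unique xs
  countᵇ≤1⇒Unique {[]}     _   = []
  countᵇ≤1⇒Unique {x ∷ xs} ≤1 =
    All.tabulate x≢ ∷ countᵇ≤1⇒Unique (λ y → ≤-trans (countᵇ-∷-≤ (y ==_) x xs) (≤1 y))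
    where
    x∉xs : x ∉ xs
    x∉xs x∈xs = countᵇ-∈ (x ==_) x∈xs (==-refl x)
      (n≤0⇒n≡0 (s≤s⁻¹ (subst (_≤ 1) (countᵇ-accept (x ==_) (==-refl x)) (≤1 x))))
    x≢ : ∀ {y} → y ∈ xs → x ≢ y
    x≢ y∈xs refl = x∉xs y∈xs


map-≡⇒≗-local : {f g : A → B} {xs : List A} → map f xs ≡ map g xs → ∀ {x} → x ∈ xs → f x ≡ g x
map-≡⇒≗-local {xs = x ∷ xs} f≡g (here refl) = proj₁ (∷-injective f≡g)
map-≡⇒≗-local {xs = x ∷ xs} f≡g (there x∈xs) = map-≡⇒≗-local (proj₂ (∷-injective f≡g)) x∈xs

All-preimage : {f : A → B} {ys : List B} → All (λ y → ∃ λ x → f x ≡ y) ys → ∃ λ xs → map f xs ≡ ys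
All-preimage []                   = [] , refl
All-preimage {f = f} ((x , refl) ∷ rest) =
  let xs , eq = All-preimage rest in x ∷ xs , cong (f x ∷_) eq

Unique-map⁺ : {f : A → B} {xs : List A} → (∀ {x y} → x ∈ xs → y ∈ xs → f x ≡ f y → x ≡ y) →
  Unique xs → Unique (map f xs)
Unique-map⁺ {xs = []}    inj []           = []
Unique-map⁺ {xs = x ∷ xs} inj (x∉xs ∷ xs!) =
  All.map⁺ (All.tabulate λ y∈xs fx≡fy → All.lookup x∉xs y∈xs (inj (here refl) (there y∈xs) fx≡fy))
  ∷ Unique-map⁺ (λ x∈ y∈ → inj (there x∈) (there y∈)) xs!

deduplicate-Unique : (_≟_ : DecidableEquality A) {xs : List A} → Unique xs → deduplicate _≟_ xs ≡ xs
deduplicate-Unique _≟_ []          = refl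
deduplicate-Unique _≟_ {x ∷ xs} (x∉xs ∷ xs!)
  rewrite deduplicate-Unique _≟_ xs! = cong (x ∷_) (filter-all (λ y → ¬? (x ≟ y)) x∉xs)

Unique⇒↭ : {xs ys : List A} → Unique xs → Unique ys →
  (∀ {z} → z ∈ xs → z ∈ ys) → (∀ {z} → z ∈ ys → z ∈ xs) → xs ↭ ys
Unique⇒↭ xs! ys! xs⊆ys ys⊆xs = ∼bag⇒↭ (unique∧set⇒bag xs! ys! (mk⇔ xs⊆ys ys⊆xs))

concatMap-map≡cartesianProductWith : (f : A → B → C) (xs : List A) (ys : List B) →
  concatMap (λ x → map (f x) ys) xs ≡ cartesianProductWith f xs ys
concatMap-map≡cartesianProductWith f []       ys = refl
concatMap-map≡cartesianProductWith f (x ∷ xs) ys =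
  cong (map (f x) ys ++_) (concatMap-map≡cartesianProductWith f xs ys)

concatMap-map≡map-cartesianProduct : (f : A × B → C) (xs : List A) (ys : List B) →
  concatMap (λ x → map (λ y → f (x , y)) ys) xs ≡ map f (cartesianProduct xs ys)
concatMap-map≡map-cartesianProduct f xs ys = begin
  concatMap (λ x → map (λ y → f (x , y)) ys) xs ≡⟨ concatMap-cong (λ x → map-∘ ys) xs ⟩
  concatMap (λ x → map f (map (x ,_) ys)) xs    ≡⟨ map-concatMap f (λ x → map (x ,_) ys) xs ⟨
  map f (concatMap (λ x → map (x ,_) ys) xs)    ≡⟨ cong (map f) (concatMap-map≡cartesianProductWith _,_ xs ys) ⟩
  map f (cartesianProduct xs ys)                ∎
  where open ≡-Reasoning

module _ {xs : List A} where

  Unique-words : Unique xs → ∀ m → Unique (words xs m)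
  Unique-words xs! zero    = [] ∷ []
  Unique-words xs! (suc m) =
    subst Unique (sym (concatMap-map≡cartesianProductWith _∷_ xs (words xs m)))
      (Unique.cartesianProductWith⁺ _∷_ ∷-injective xs! (Unique-words xs! m))

  ∈-words⁺ : {ys : List A} → All (_∈ xs) ys → ys ∈ words xs (length ys)
  ∈-words⁺ {[]}     []            = here refl
  ∈-words⁺ {y ∷ ys} (y∈xs ∷ ys⊆xs) =
    subst (y ∷ ys ∈_) (sym (concatMap-map≡cartesianProductWith _∷_ xs (words xs (length ys))))
      (∈-cartesianProductWith⁺ _∷_ y∈xs (∈-words⁺ ys⊆xs))

  ∈-words⁻ : ∀ m {ys : List A} → ys ∈ words xs m → length ys ≡ m × All (_∈ xs) ys
  ∈-words⁻ zero    (here refl) = refl , []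
  ∈-words⁻ (suc m) ys∈
    with ∈-cartesianProductWith⁻ _∷_ xs (words xs m)
           (subst (_ ∈_) (concatMap-map≡cartesianProductWith _∷_ xs (words xs m)) ys∈)
  ... | y , zs , y∈xs , zs∈ , refl with ∈-words⁻ m zs∈
  ...   | length≡ , zs⊆xs = cong suc length≡ , y∈xs ∷ zs⊆xs

  Unique-vecs : Unique xs → ∀ n → Unique (vecs xs n)
  Unique-vecs xs! zero    = [] ∷ []
  Unique-vecs xs! (suc n) =
    subst Unique (sym (concatMap-map≡cartesianProductWith Vec._∷_ xs (vecs xs n)))
      (Unique.cartesianProductWith⁺ Vec._∷_ Vecₚ.∷-injective xs! (Unique-vecs xs! n))

  ∈-vecs : (∀ x → x ∈ xs) → ∀ {n} (ws : Vec A n) → ws ∈ vecs xs n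
  ∈-vecs complete Vec.[]         = here refl
  ∈-vecs complete (w Vec.∷ ws) =
    subst (_ ∈_) (sym (concatMap-map≡cartesianProductWith Vec._∷_ xs (vecs xs _)))
      (∈-cartesianProductWith⁺ Vec._∷_ (complete w) (∈-vecs complete ws))


-- Descents under a monotone map

isYes-⇔ : {P Q : Set} → P ⇔ Q → (p? : Dec P) (q? : Dec Q) → ⌊ p? ⌋ ≡ ⌊ q? ⌋
isYes-⇔ P⇔Q p? q? = trans (isYes≗does p?) (trans (does-⇔ P⇔Q p? q?) (sym (isYes≗does q?)))

desB-map : {f : ℤ → ℤ} → f Preserves ℤ._≤_ ⟶ ℤ._≤_ → (∀ x → (+ 0 ℤ.< f x) ⇔ (+ 0 ℤ.< x)) →
  {σ : List ℤ} → Linked (λ x y → y ℤ.< x → f y ≢ f x) σ → desB (map f σ) ≡ desB σ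
desB-map mono positive [] = refl
desB-map {f} mono positive {x ∷ []} [-] =
  cong (λ b → if b then 1 else 0) (isYes-⇔ (positive x) (+ 0 ℤ.<? f x) (+ 0 ℤ.<? x))
desB-map {f} mono positive {x ∷ y ∷ σ} (noTie ∷ linked) =
  cong₂ (λ b d → (if b then 1 else 0) + d) (isYes-⇔ descent (f y ℤ.<? f x) (y ℤ.<? x)) (desB-map mono positive linked)
  where
  descent : (f y ℤ.< f x) ⇔ (y ℤ.< x)
  descent = mk⇔ (λ fy<fx → ≰⇒> (λ x≤y → <⇒≱ fy<fx (mono x≤y)))
                (λ y<x → ≤∧≢⇒< (mono (<⇒≤ y<x)) (noTie y<x))

-- x ↦ sign(x)·⌈|x|/2⌉, which sends both ±2i and ±(2i−1) to ±i.
collapse : ℤ → ℤ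
collapse (+ n)    = + ⌈ n /2⌉
collapse -[1+ n ] = -[1+ ⌊ n /2⌋ ]

collapse-mono : collapse Preserves ℤ._≤_ ⟶ ℤ._≤_
collapse-mono (-≤- n≤m) = -≤- (⌊n/2⌋-mono n≤m)
collapse-mono -≤+       = -≤+
collapse-mono (+≤+ m≤n) = +≤+ (⌈n/2⌉-mono m≤n)

collapse-positive : ∀ x → (+ 0 ℤ.< collapse x) ⇔ (+ 0 ℤ.< x)
collapse-positive (+ zero)  = mk⇔ (λ 0<0 → 0<0) (λ 0<0 → 0<0)
collapse-positive (+ suc n) = mk⇔ (λ _ → +<+ z<s) (λ _ → +<+ z<s)
collapse-positive -[1+ n ]  = mk⇔ (λ ()) (λ ())


withSign : Bool → ℕ → ℤ
withSign true  m = + m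
withSign false m = - (+ m)

signed : Bool → ℕ → ℤ
signed true  k = + suc k
signed false k = -[1+ k ]

signed-injective : ∀ {b b′ k k′} → signed b k ≡ signed b′ k′ → b ≡ b′ × k ≡ k′
signed-injective {true}  {true}  refl = refl , refl
signed-injective {false} {false} refl = refl , refl

∣signed∣ : ∀ b k → ∣ signed b k ∣ ≡ suc k
∣signed∣ true  k = refl
∣signed∣ false k = refl

2*suc : ∀ a → 2 * suc a ≡ suc (suc (a + a))
2*suc a = cong suc (trans (cong (a ℕ.+_) (+-identityʳ (suc a))) (+-suc a a))

collapse-even : ∀ b a → collapse (withSign b (2 * suc a)) ≡ signed b a
collapse-even b a = trans (cong (λ m → collapse (withSign b m)) (2*suc a)) (even b)
  where
  even : ∀ b → collapse (withSign b (suc (suc (a + a)))) ≡ signed b a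
  even true  = cong (λ m → + suc m) (sym (n≡⌈n+n/2⌉ a))
  even false = cong -[1+_] (sym (n≡⌈n+n/2⌉ a))

collapse-odd : ∀ b a → collapse (withSign b (2 * suc a ∸ 1)) ≡ signed b a
collapse-odd b a = trans (cong (λ m → collapse (withSign b (m ∸ 1))) (2*suc a)) (odd b)
  where
  odd : ∀ b → collapse (withSign b (suc (a + a))) ≡ signed b a
  odd true  = cong (λ m → + suc m) (sym (n≡⌊n+n/2⌋ a))
  odd false = cong -[1+_] (sym (n≡⌊n+n/2⌋ a))

rootSign childSign : Choice → Bool
rootSign c1  = true
rootSign c2  = true
rootSign c3  = false
rootSign c4  = false
childSign c1 = true
childSign c2 = false
childSign c3 = true
childSign c4 = false

choice : Bool → Bool → Choice
choice true  true  = c1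
choice true  false = c2
choice false true  = c3
choice false false = c4

choice-signs : ∀ c → choice (rootSign c) (childSign c) ≡ c
choice-signs c1 = refl
choice-signs c2 = refl
choice-signs c3 = refl
choice-signs c4 = refl

rootSign-choice : ∀ r c → rootSign (choice r c) ≡ r
rootSign-choice true  true  = refl
rootSign-choice true  false = refl
rootSign-choice false true  = refl
rootSign-choice false false = refl

childSign-choice : ∀ r c → childSign (choice r c) ≡ c
childSign-choice true  true  = refl
childSign-choice true  false = refl
childSign-choice false true  = refl
childSign-choice false false = refl


module Forest (n : ℕ) where

  open import Data.List.Membership.DecPropositional (Fin._≟_ {n}) using (_∈?_)

  tree : Vtx n → Fin n
  tree (u i) = i
  tree (v i) = i

  ==V⇒≡ : ∀ {x y : Vtx n} → T (x ==V y) → x ≡ y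
  ==V⇒≡ {u i} {u j} i≡j = cong u (toWitness i≡j)
  ==V⇒≡ {v i} {v j} i≡j = cong v (toWitness i≡j)

  ==V-refl : (x : Vtx n) → T (x ==V x)
  ==V-refl (u i) = fromWitness refl
  ==V-refl (v i) = fromWitness refl

  v<Fu : (i : Fin n) → T (v i <F u i)
  v<Fu i = fromWitness refl

  <F⇒sameTree : ∀ {x y : Vtx n} → T (y <F x) → tree y ≡ tree x
  <F⇒sameTree {u i} {v j} j≡i = toWitness j≡i

  Respects : List (Vtx n) → Set
  Respects = AllPairs (λ x y → ¬ T (y <F x))

  -- Linear extensions and their tree words

  occurrences : Fin n → List (Fin n) → ℕ
  occurrences i = countᵇ (λ j → ⌊ i Fin.≟ j ⌋)

  occurrences-∉ : ∀ {i is} → i ∉ is → occurrences i is ≡ 0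
  occurrences-∉ = countᵇ-∉ {_==_ = λ i j → ⌊ i Fin.≟ j ⌋} toWitness (λ _ → fromWitness refl)

  ∈-occurrences : ∀ {i} is → occurrences i is ≢ 0 → i ∈ is
  ∈-occurrences = ∈-countᵇ {_==_ = λ i j → ⌊ i Fin.≟ j ⌋} toWitness (λ _ → fromWitness refl)

  countᵇ-root+child : ∀ i (xs : List (Vtx n)) →
    countᵇ (u i ==V_) xs + countᵇ (v i ==V_) xs ≡ occurrences i (map tree xs)
  countᵇ-root+child i []         = refl
  countᵇ-root+child i (u j ∷ xs) with i Fin.≟ j
  ... | yes _ = cong suc (countᵇ-root+child i xs)
  ... | no  _ = countᵇ-root+child i xs
  countᵇ-root+child i (v j ∷ xs) with i Fin.≟ j
  ... | yes _ = trans (+-suc _ _) (cong suc (countᵇ-root+child i xs))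
  ... | no  _ = countᵇ-root+child i xs

  vertexFor : Fin n → List (Fin n) → Vtx n
  vertexFor i is = if does (i ∈? is) then v i else u i

  tree-vertexFor : ∀ i is → tree (vertexFor i is) ≡ i
  tree-vertexFor i is with i ∈? is
  ... | yes _ = refl
  ... | no  _ = refl

  shape : List (Fin n) → List (Vtx n)
  shape []       = []
  shape (i ∷ is) = vertexFor i is ∷ shape is

  map-tree-shape : ∀ is → map tree (shape is) ≡ is
  map-tree-shape []       = refl
  map-tree-shape (i ∷ is) = cong₂ _∷_ (tree-vertexFor i is) (map-tree-shape is)

  countᵇ-root-shape : ∀ {i} is → i ∈ is → countᵇ (u i ==V_) (shape is) ≡ 1
  countᵇ-root-shape {i} (j ∷ is) i∈ with j ∈? is | i∈
  ... | yes j∈is | here refl  = countᵇ-root-shape is j∈is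
  ... | yes _    | there i∈is = countᵇ-root-shape is i∈is
  ... | no  j∉is | here refl  = trans (countᵇ-accept (u j ==V_) {u j} {shape is} (==V-refl (u j))) (cong suc noRoot)
    where
    noRoot : countᵇ (u j ==V_) (shape is) ≡ 0
    noRoot = m+n≡0⇒m≡0 _ (begin
      countᵇ (u j ==V_) (shape is) + countᵇ (v j ==V_) (shape is) ≡⟨ countᵇ-root+child j (shape is) ⟩
      occurrences j (map tree (shape is))                          ≡⟨ cong (occurrences j) (map-tree-shape is) ⟩
      occurrences j is                                             ≡⟨ occurrences-∉ j∉is ⟩
      0                                                            ∎)
      where open ≡-Reasoning
  ... | no  j∉is | there i∈is =
    trans (countᵇ-reject (u i ==V_) {u j} {shape is} λ ui==uj → j∉is (subst (_∈ is) (u-injective (==V⇒≡ ui==uj)) i∈is))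
          (countᵇ-root-shape is i∈is)
    where
    u-injective : ∀ {i j} → Vtx.u {n} i ≡ u j → i ≡ j
    u-injective refl = refl

  shape-respects : ∀ is → Respects (shape is)
  shape-respects []       = []
  shape-respects (i ∷ is) with i ∈? is
  ... | yes _    = All.tabulate (λ {y} _ → notBelowChild y) ∷ shape-respects is
    where
    notBelowChild : ∀ y → ¬ T (y <F v i)
    notBelowChild (u _) ()
    notBelowChild (v _) ()
  ... | no  i∉is = All.tabulate (λ {y} y∈ y<Fui → i∉is (subst (_∈ is) (<F⇒sameTree {u i} {y} y<Fui)
                     (subst (_ ∈_) (map-tree-shape is) (∈-map⁺ tree y∈)))) ∷ shape-respects is

  shape-occursOnce : ∀ {is} → (∀ i → occurrences i is ≡ 2) → ∀ y → countᵇ (y ==V_) (shape is) ≡ 1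
  shape-occursOnce {is} twice = occursOnce
    where
    open ≡-Reasoning
    i∈is : ∀ i → i ∈ is
    i∈is i = ∈-occurrences is (λ 2≡0 → case trans (sym (twice i)) 2≡0 of λ ())
    occursOnce : ∀ y → countᵇ (y ==V_) (shape is) ≡ 1
    occursOnce (u i) = countᵇ-root-shape is (i∈is i)
    occursOnce (v i) = +-cancelˡ-≡ 1 _ _ (begin
      1 + countᵇ (v i ==V_) (shape is)                             ≡⟨ cong (_+ countᵇ (v i ==V_) (shape is)) (countᵇ-root-shape is (i∈is i)) ⟨
      countᵇ (u i ==V_) (shape is) + countᵇ (v i ==V_) (shape is) ≡⟨ countᵇ-root+child i (shape is) ⟩
      occurrences i (map tree (shape is))                          ≡⟨ cong (occurrences i) (map-tree-shape is) ⟩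
      occurrences i is                                             ≡⟨ twice i ⟩
      2                                                            ∎)

  vertexFor-tree : ∀ x xs → All (x ≢_) xs → All (λ y → ¬ T (y <F x)) xs →
    (∀ {i} → v i ∈ x ∷ xs → u i ∈ x ∷ xs) → vertexFor (tree x) (map tree xs) ≡ x
  vertexFor-tree (u i) xs x∉xs xs≮x _ with i ∈? map tree xs
  ... | no _   = refl
  ... | yes i∈ with ∈-map⁻ tree i∈
  ...   | u j , uj∈xs , refl = ⊥-elim (All.lookup x∉xs uj∈xs refl)
  ...   | v j , vj∈xs , refl = ⊥-elim (All.lookup xs≮x vj∈xs (v<Fu j))
  vertexFor-tree (v i) xs _ _ closed with i ∈? map tree xs
  ... | yes _ = refl
  ... | no i∉ with closed (here refl)
  ...   | there ui∈xs = ⊥-elim (i∉ (∈-map⁺ tree ui∈xs))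

  shape-map-tree : ∀ {xs} → Unique xs → Respects xs → (∀ {i} → v i ∈ xs → u i ∈ xs) → shape (map tree xs) ≡ xs
  shape-map-tree {[]}     _              _              _      = refl
  shape-map-tree {x ∷ xs} (x∉xs ∷ xs!) (xs≮x ∷ resp) closed =
    cong₂ _∷_ (vertexFor-tree x xs x∉xs xs≮x closed) (shape-map-tree xs! resp closed′)
    where
    closed′ : ∀ {i} → v i ∈ xs → u i ∈ xs
    closed′ {i} vi∈xs with closed (there vi∈xs)
    ... | here refl   = ⊥-elim (All.lookup xs≮x vi∈xs (v<Fu i))
    ... | there ui∈xs = ui∈xs

  respectsF⇔Respects : ∀ xs → T (respectsF xs) ⇔ Respects xs
  respectsF⇔Respects []       = mk⇔ (λ _ → []) (λ _ → _)
  respectsF⇔Respects (x ∷ xs) = mk⇔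
    (λ t → let below , rest = Equivalence.to T-∧ t in
           All.map (Equivalence.to T-not) (all⁺ _ xs below) ∷ Equivalence.to (respectsF⇔Respects xs) rest)
    (λ { (xs≮x ∷ resp) → Equivalence.from T-∧
           (all⁻ _ (All.map (Equivalence.from T-not) xs≮x) , Equivalence.from (respectsF⇔Respects xs) resp) })

  ∈-allVtx : ∀ y → y ∈ allVtx n
  ∈-allVtx (u i) = ∈-++⁺ˡ (∈-map⁺ u (∈-allFin i))
  ∈-allVtx (v i) = ∈-++⁺ʳ (map u (allFin n)) (∈-map⁺ v (∈-allFin i))

  record LinearExtension (xs : List (Vtx n)) : Set where
    field
      length≡    : length xs ≡ 2 * n
      occursOnce : ∀ y → countᵇ (y ==V_) xs ≡ 1
      respects   : Respects xs

    complete : ∀ y → y ∈ xs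
    complete y = ∈-countᵇ ==V⇒≡ ==V-refl xs (λ c≡0 → case trans (sym (occursOnce y)) c≡0 of λ ())

    unique : Unique xs
    unique = countᵇ≤1⇒Unique ==V⇒≡ ==V-refl (λ y → ≤-reflexive (occursOnce y))

    shape-trees : shape (map tree xs) ≡ xs
    shape-trees = shape-map-tree unique respects (λ {i} _ → complete (u i))

    occurrences-trees : ∀ i → occurrences i (map tree xs) ≡ 2
    occurrences-trees i = trans (sym (countᵇ-root+child i xs)) (cong₂ _+_ (occursOnce (u i)) (occursOnce (v i)))

  open LinearExtension using (complete; unique; shape-trees; occurrences-trees)

  ∈-linExts⇔ : ∀ {xs} → xs ∈ linExts n ⇔ LinearExtension xs
  ∈-linExts⇔ {xs} = mk⇔ to from
    where
    isLinExt : List (Vtx n) → Bool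
    isLinExt xs = isArrangement xs ∧ respectsF xs
    to : xs ∈ linExts n → LinearExtension xs
    to xs∈ =
      let xs∈words , t = ∈-filter⁻ (T? ∘ isLinExt) {xs = words (allVtx n) (2 * n)} xs∈
          arrangement , respecting = Equivalence.to T-∧ t
      in record
        { length≡    = proj₁ (∈-words⁻ (2 * n) xs∈words)
        ; occursOnce = λ y → ≡ᵇ⇒≡ _ 1 (All.lookup (all⁺ _ (allVtx n) arrangement) (∈-allVtx y))
        ; respects   = Equivalence.to (respectsF⇔Respects xs) respecting
        }
    from : LinearExtension xs → xs ∈ linExts n
    from ext = ∈-filter⁺ (T? ∘ isLinExt)
      (subst (λ m → xs ∈ words (allVtx n) m) length≡ (∈-words⁺ (All.tabulate (λ {y} _ → ∈-allVtx y))))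
      (Equivalence.from T-∧
        ( all⁻ (λ y → countᵇ (y ==V_) xs ℕ.≡ᵇ 1) {allVtx n} (All.tabulate (λ {y} _ → ≡⇒≡ᵇ _ 1 (occursOnce y)))
        , Equivalence.from (respectsF⇔Respects xs) respects))
      where open LinearExtension ext

  shape-linearExtension : ∀ {is} → length is ≡ 2 * n → (∀ i → occurrences i is ≡ 2) → LinearExtension (shape is)
  shape-linearExtension {is} length≡ twice = record
    { length≡    = trans (sym (length-map tree (shape is))) (trans (cong length (map-tree-shape is)) length≡)
    ; occursOnce = shape-occursOnce {is} twice
    ; respects   = shape-respects is
    }

  Letter : Set
  Letter = Bool × Fin n

  signedLetter : Letter → ℤ
  signedLetter (b , i) = signed b (toℕ i)

  sign : Labeling n → Vtx n → Bool
  sign w (u i) = rootSign (lookup w i)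
  sign w (v i) = childSign (lookup w i)

  letterOf : Labeling n → Vtx n → Letter
  letterOf w x = sign w x , tree x

  labelingOf : (Vtx n → Bool) → Labeling n
  labelingOf s = tabulate (λ i → choice (s (u i)) (s (v i)))

  sign-labelingOf : ∀ s x → sign (labelingOf s) x ≡ s x
  sign-labelingOf s (u i) = trans (cong rootSign (lookup∘tabulate _ i)) (rootSign-choice _ _)
  sign-labelingOf s (v i) = trans (cong childSign (lookup∘tabulate _ i)) (childSign-choice _ _)

  labelingOf-sign : ∀ w → labelingOf (sign w) ≡ w
  labelingOf-sign w = trans (tabulate-cong (λ i → choice-signs (lookup w i))) (tabulate∘lookup w)

  sign-injective : ∀ {w w′} → (∀ x → sign w x ≡ sign w′ x) → w ≡ w′
  sign-injective {w} {w′} same = begin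
    w                       ≡⟨ labelingOf-sign w ⟨
    labelingOf (sign w)     ≡⟨ tabulate-cong (λ i → cong₂ choice (same (u i)) (same (v i))) ⟩
    labelingOf (sign w′)    ≡⟨ labelingOf-sign w′ ⟩
    w′                      ∎
    where open ≡-Reasoning

  collapse-label : ∀ w x → collapse (label w x) ≡ signedLetter (letterOf w x)
  collapse-label w (u i) with lookup w i
  ... | c1 = collapse-even true  (toℕ i)
  ... | c2 = collapse-even true  (toℕ i)
  ... | c3 = collapse-even false (toℕ i)
  ... | c4 = collapse-odd  false (toℕ i)
  collapse-label w (v i) with lookup w i
  ... | c1 = collapse-odd  true  (toℕ i)
  ... | c2 = collapse-odd  false (toℕ i)
  ... | c3 = collapse-odd  true  (toℕ i)
  ... | c4 = collapse-even false (toℕ i)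

  root-child-tie : ∀ w i → signedLetter (letterOf w (u i)) ≡ signedLetter (letterOf w (v i)) →
    ¬ label w (u i) ℤ.< label w (v i)
  root-child-tie w i with lookup w i
  ... | c1 = λ _ u<v → <-asym u<v (+<+ (n<1+n _))
  ... | c2 = λ ()
  ... | c3 = λ ()
  ... | c4 = λ _ u<v → <-asym u<v (neg-mono-< (+<+ (n<1+n _)))

  tie⇒below : ∀ w {x y} → signedLetter (letterOf w y) ≡ signedLetter (letterOf w x) →
    label w y ℤ.< label w x → T (y <F x)
  tie⇒below w {u i} {u j} tie y<x with toℕ-injective (proj₂ (signed-injective tie))
  ... | refl = ⊥-elim (<-irrefl refl y<x)
  tie⇒below w {v i} {v j} tie y<x with toℕ-injective (proj₂ (signed-injective tie))
  ... | refl = ⊥-elim (<-irrefl refl y<x)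
  tie⇒below w {u i} {v j} tie y<x with toℕ-injective (proj₂ (signed-injective tie))
  ... | refl = v<Fu i
  tie⇒below w {v i} {u j} tie y<x with toℕ-injective (proj₂ (signed-injective tie))
  ... | refl = ⊥-elim (root-child-tie w i tie y<x)

  encode : Labeling n × List (Vtx n) → List ℤ
  encode (w , xs) = map signedLetter (map (letterOf w) xs)

  encode≡collapse : ∀ w xs → encode (w , xs) ≡ map collapse (map (label w) xs)
  encode≡collapse w xs = begin
    map signedLetter (map (letterOf w) xs) ≡⟨ map-∘ xs ⟨
    map (signedLetter ∘ letterOf w) xs     ≡⟨ map-cong (λ x → sym (collapse-label w x)) xs ⟩
    map (collapse ∘ label w) xs            ≡⟨ map-∘ xs ⟩
    map collapse (map (label w) xs)        ∎
    where open ≡-Reasoning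

  desB-label : ∀ w {xs} → Respects xs → desB (map (label w) xs) ≡ desB (encode (w , xs))
  desB-label w {xs} resp = trans
    (sym (desB-map collapse-mono collapse-positive
      (Linked.map⁺ (Linked.map (λ {x} {y} → noTie {x} {y}) (AllPairs⇒Linked resp)))))
    (cong desB (sym (encode≡collapse w xs)))
    where
    noTie : ∀ {x y} → ¬ T (y <F x) → label w y ℤ.< label w x → collapse (label w y) ≢ collapse (label w x)
    noTie {x} {y} y≮x y<x tie =
      y≮x (tie⇒below w {x} {y} (trans (sym (collapse-label w y)) (trans tie (collapse-label w x))) y<x)

  -- Collapsing is a bijection onto P_n

  signedLetter-injective : ∀ {l l′} → signedLetter l ≡ signedLetter l′ → l ≡ l′
  signedLetter-injective {b , i} eq with signed-injective eq
  ... | refl , i≡i′ = cong (b ,_) (toℕ-injective i≡i′)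

  encode-injective : ∀ {w w′ xs xs′} → LinearExtension xs → LinearExtension xs′ →
    encode (w , xs) ≡ encode (w′ , xs′) → (w , xs) ≡ (w′ , xs′)
  encode-injective {w} {w′} {xs} {xs′} ext ext′ eq = cong₂ _,_ (sign-injective signs≡) xs≡xs′
    where
    open ≡-Reasoning
    letters≡ : map (letterOf w) xs ≡ map (letterOf w′) xs′
    letters≡ = map-injective signedLetter-injective eq
    xs≡xs′ : xs ≡ xs′
    xs≡xs′ = begin
      xs                   ≡⟨ shape-trees ext ⟨
      shape (map tree xs)  ≡⟨ cong shape (trans (map-∘ xs) (trans (cong (map proj₂) letters≡) (sym (map-∘ xs′)))) ⟩
      shape (map tree xs′) ≡⟨ shape-trees ext′ ⟩
      xs′                  ∎
    signs≡ : ∀ x → sign w x ≡ sign w′ x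
    signs≡ x = cong proj₁ (map-≡⇒≗-local (trans letters≡ (cong (map (letterOf w′)) (sym xs≡xs′))) (complete ext x))

  signedAlphabet≡ : signedAlphabet n ≡ cartesianProductWith (λ k b → signed b k) (upTo n) (true ∷ false ∷ [])
  signedAlphabet≡ = concatMap-map≡cartesianProductWith (λ k b → signed b k) (upTo n) (true ∷ false ∷ [])

  ∈-signedAlphabet⁺ : ∀ l → signedLetter l ∈ signedAlphabet n
  ∈-signedAlphabet⁺ (b , i) = subst (signed b (toℕ i) ∈_) (sym signedAlphabet≡)
    (∈-cartesianProductWith⁺ (λ k b → signed b k) (∈-upTo⁺ (toℕ<n i)) (bool∈ b))
    where
    bool∈ : ∀ b → b ∈ true ∷ false ∷ []
    bool∈ true  = here refl
    bool∈ false = there (here refl)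

  ∈-signedAlphabet⁻ : ∀ {x} → x ∈ signedAlphabet n → ∃ λ l → signedLetter l ≡ x
  ∈-signedAlphabet⁻ x∈ with ∈-cartesianProductWith⁻ (λ k b → signed b k) (upTo n) (true ∷ false ∷ [])
                              (subst (_ ∈_) signedAlphabet≡ x∈)
  ... | k , b , k∈ , _ , refl = (b , Fin.fromℕ< (∈-upTo⁻ k∈)) , cong (signed b) (toℕ-fromℕ< (∈-upTo⁻ k∈))

  countᵇ-∣∣ : ∀ i ls →
    countᵇ (λ x → ∣ x ∣ ℕ.≡ᵇ suc (toℕ i)) (map signedLetter ls) ≡ occurrences i (map proj₂ ls)
  countᵇ-∣∣ i ls = begin
    countᵇ (λ x → ∣ x ∣ ℕ.≡ᵇ suc (toℕ i)) (map signedLetter ls) ≡⟨ countᵇ-map _ signedLetter ls ⟩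
    countᵇ (λ l → ∣ signedLetter l ∣ ℕ.≡ᵇ suc (toℕ i)) ls      ≡⟨ countᵇ-cong-local (All.universal sameTree ls) ⟩
    countᵇ (λ l → ⌊ i Fin.≟ proj₂ l ⌋) ls                       ≡⟨ countᵇ-map _ proj₂ ls ⟨
    occurrences i (map proj₂ ls)                                ∎
    where
    open ≡-Reasoning
    sameTree : ∀ l → (∣ signedLetter l ∣ ℕ.≡ᵇ suc (toℕ i)) ≡ ⌊ i Fin.≟ proj₂ l ⌋
    sameTree (b , j) rewrite ∣signed∣ b (toℕ j) =
      trans (does-⇔ (mk⇔ (sym ∘ toℕ-injective) (cong toℕ ∘ sym)) (toℕ j ℕ.≟ toℕ i) (i Fin.≟ j))
            (sym (isYes≗does (i Fin.≟ j)))

  SignedPermutation : List Letter → Set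
  SignedPermutation ls = length ls ≡ 2 * n × (∀ i → occurrences i (map proj₂ ls) ≡ 2)

  ∈-Pset⇔ : ∀ {σ} → σ ∈ Pset n ⇔ (∃ λ ls → map signedLetter ls ≡ σ × SignedPermutation ls)
  ∈-Pset⇔ {σ} = mk⇔ to from
    where
    to : σ ∈ Pset n → ∃ λ ls → map signedLetter ls ≡ σ × SignedPermutation ls
    to σ∈ =
      let σ∈words , isPerm  = ∈-filter⁻ (T? ∘ isSignedPerm n) {xs = words (signedAlphabet n) (2 * n)} σ∈
          length≡ , letters = ∈-words⁻ (2 * n) σ∈words
          ls , ls↦σ         = All-preimage (All.map ∈-signedAlphabet⁻ letters)
          twice : ∀ i → occurrences i (map proj₂ ls) ≡ 2
          twice i = trans (sym (countᵇ-∣∣ i ls)) (trans (cong (countᵇ _) ls↦σ)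
                      (≡ᵇ⇒≡ _ 2 (All.lookup (all⁺ _ (upTo n) isPerm) (∈-upTo⁺ (toℕ<n i)))))
      in ls , ls↦σ , trans (sym (length-map signedLetter ls)) (trans (cong length ls↦σ) length≡) , twice
    from : (∃ λ ls → map signedLetter ls ≡ σ × SignedPermutation ls) → σ ∈ Pset n
    from (ls , refl , length≡ , twice) = ∈-filter⁺ (T? ∘ isSignedPerm n)
      (subst (λ m → σ ∈ words (signedAlphabet n) m) (trans (length-map signedLetter ls) length≡)
        (∈-words⁺ (All.map⁺ (All.universal ∈-signedAlphabet⁺ ls))))
      (all⁻ (λ k → countᵇ (λ x → ∣ x ∣ ℕ.≡ᵇ suc k) σ ℕ.≡ᵇ 2) (All.tabulate λ {k} k∈ →
        let i = Fin.fromℕ< (∈-upTo⁻ k∈) in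
        ≡⇒≡ᵇ _ 2 (subst (λ k → countᵇ (λ x → ∣ x ∣ ℕ.≡ᵇ suc k) σ ≡ 2) (toℕ-fromℕ< (∈-upTo⁻ k∈))
                    (trans (countᵇ-∣∣ i ls) (twice i)))))

  signs-exist : ∀ ls → Unique (shape (map proj₂ ls)) →
    ∃ λ (s : Vtx n → Bool) → map (λ y → s y , tree y) (shape (map proj₂ ls)) ≡ ls
  signs-exist []             _             = (λ _ → true) , refl
  signs-exist ((b , i) ∷ ls) (y∉ys ∷ ys!) =
    s′ , cong₂ _∷_ (cong₂ _,_ s′-here (tree-vertexFor i (map proj₂ ls)))
                   (trans (map-cong-local (All.map (λ {z} y≢z → cong (_, tree z) (s′-other y≢z)) y∉ys)) ys↦ls)
    where
    y = vertexFor i (map proj₂ ls)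
    s = proj₁ (signs-exist ls ys!)
    ys↦ls = proj₂ (signs-exist ls ys!)
    s′ : Vtx n → Bool
    s′ z = if y ==V z then b else s z
    s′-here : s′ y ≡ b
    s′-here with y ==V y | ==V-refl y
    ... | true | _ = refl
    s′-other : ∀ {z} → y ≢ z → s′ z ≡ s z
    s′-other {z} y≢z with y ==V z in y==z
    ... | true  = ⊥-elim (y≢z (==V⇒≡ (subst T (sym y==z) _)))
    ... | false = refl

  Unique-allVtx : Unique (allVtx n)
  Unique-allVtx = Unique.++⁺ (Unique.map⁺ (λ { refl → refl }) (Unique.allFin⁺ n))
                             (Unique.map⁺ (λ { refl → refl }) (Unique.allFin⁺ n)) disjoint
    where
    disjoint : ∀ {x} → ¬ (x ∈ map u (allFin n) × x ∈ map v (allFin n))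
    disjoint (x∈us , x∈vs) with ∈-map⁻ u x∈us | ∈-map⁻ v x∈vs
    ... | _ , _ , refl | _ , _ , ()

  Unique-signedAlphabet : Unique (signedAlphabet n)
  Unique-signedAlphabet = subst Unique (sym signedAlphabet≡)
    (Unique.cartesianProductWith⁺ _ (swap ∘ signed-injective) (Unique.upTo⁺ n) (((λ ()) ∷ []) ∷ [] ∷ []))

  Unique-labelings : Unique (labelings n)
  Unique-labelings =
    Unique-vecs (((λ ()) ∷ (λ ()) ∷ (λ ()) ∷ []) ∷ ((λ ()) ∷ (λ ()) ∷ []) ∷ ((λ ()) ∷ []) ∷ [] ∷ []) n

  ∈-labelings : ∀ w → w ∈ labelings n
  ∈-labelings = ∈-vecs λ where
    c1 → here refl
    c2 → there (here refl)
    c3 → there (there (here refl))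
    c4 → there (there (there (here refl)))

  Unique-linExts : Unique (linExts n)
  Unique-linExts = Unique.filter⁺ _ (Unique-words Unique-allVtx (2 * n))

  encode-∈-Pset : ∀ w {xs} → LinearExtension xs → encode (w , xs) ∈ Pset n
  encode-∈-Pset w {xs} ext = Equivalence.from ∈-Pset⇔
    ( map (letterOf w) xs , refl
    , trans (length-map (letterOf w) xs) (LinearExtension.length≡ ext)
    , λ i → trans (cong (occurrences i) (sym (map-∘ xs))) (occurrences-trees ext i))

  encode-onto-letters : ∀ ls → SignedPermutation ls →
    ∃ λ w → ∃ λ xs → LinearExtension xs × encode (w , xs) ≡ map signedLetter ls
  encode-onto-letters ls (length≡ , twice) = labelingOf s , xs , ext , encode≡
    where
    xs : List (Vtx n)
    xs = shape (map proj₂ ls)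
    ext : LinearExtension xs
    ext = shape-linearExtension (trans (length-map proj₂ ls) length≡) twice
    s : Vtx n → Bool
    s = proj₁ (signs-exist ls (unique ext))
    encode≡ : encode (labelingOf s , xs) ≡ map signedLetter ls
    encode≡ = cong (map signedLetter)
      (trans (map-cong (λ y → cong (_, tree y) (sign-labelingOf s y)) xs) (proj₂ (signs-exist ls (unique ext))))

  Encodings : List (List ℤ)
  Encodings = map encode (cartesianProduct (labelings n) (linExts n))

  Encodings↭Pset : Encodings ↭ Pset n
  Encodings↭Pset = Unique⇒↭
    (Unique-map⁺ injective (Unique.cartesianProduct⁺ Unique-labelings Unique-linExts))
    (Unique.filter⁺ _ (Unique-words Unique-signedAlphabet (2 * n)))
    sound complete-encodings
    where
    linExt : ∀ {w xs} → (w , xs) ∈ cartesianProduct (labelings n) (linExts n) → LinearExtension xs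
    linExt p∈ = Equivalence.to ∈-linExts⇔ (proj₂ (∈-cartesianProduct⁻ (labelings n) (linExts n) p∈))
    injective : ∀ {p p′} → p ∈ cartesianProduct (labelings n) (linExts n) →
      p′ ∈ cartesianProduct (labelings n) (linExts n) → encode p ≡ encode p′ → p ≡ p′
    injective {_ , _} {_ , _} p∈ p′∈ = encode-injective (linExt p∈) (linExt p′∈)
    sound : ∀ {σ} → σ ∈ Encodings → σ ∈ Pset n
    sound σ∈ with ∈-map⁻ encode σ∈
    ... | (w , _) , p∈ , refl = encode-∈-Pset w (linExt p∈)
    complete-encodings : ∀ {σ} → σ ∈ Pset n → σ ∈ Encodings
    complete-encodings σ∈ with Equivalence.to ∈-Pset⇔ σ∈
    ... | ls , refl , perm with encode-onto-letters ls perm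
    ...   | w , xs , ext , encode≡ = subst (_∈ Encodings) encode≡
      (∈-map⁺ encode (∈-cartesianProduct⁺ (∈-labelings w) (Equivalence.from ∈-linExts⇔ ext)))

  countᵇ-Lset : ∀ k w → countᵇ (λ σ → desB σ ℕ.≡ᵇ k) (Lset n w)
                      ≡ countᵇ (λ σ → desB σ ℕ.≡ᵇ k) (map (λ xs → encode (w , xs)) (linExts n))
  countᵇ-Lset k w = begin
    countᵇ q (Lset n w)                                   ≡⟨ cong (countᵇ q) (deduplicate-Unique (≡-dec ℤ._≟_) labelled!) ⟩
    countᵇ q (map (map (label w)) (linExts n))            ≡⟨ countᵇ-map q (map (label w)) (linExts n) ⟩
    countᵇ (q ∘ map (label w)) (linExts n)                ≡⟨ countᵇ-cong-local (All.tabulate λ xs∈ →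
                                                               cong (ℕ._≡ᵇ k) (desB-label w (respects xs∈))) ⟩
    countᵇ (λ xs → q (encode (w , xs))) (linExts n)       ≡⟨ countᵇ-map q (λ xs → encode (w , xs)) (linExts n) ⟨
    countᵇ q (map (λ xs → encode (w , xs)) (linExts n))   ∎
    where
    open ≡-Reasoning
    q : List ℤ → Bool
    q σ = desB σ ℕ.≡ᵇ k
    respects : ∀ {xs} → xs ∈ linExts n → Respects xs
    respects xs∈ = LinearExtension.respects (Equivalence.to ∈-linExts⇔ xs∈)
    labelled! : Unique (map (map (label w)) (linExts n))
    labelled! = Unique-map⁺ (λ {xs} {xs′} xs∈ xs′∈ eq → cong proj₂ (encode-injective
        (Equivalence.to ∈-linExts⇔ xs∈) (Equivalence.to ∈-linExts⇔ xs′∈)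
        (trans (encode≡collapse w xs) (trans (cong (map collapse) eq) (sym (encode≡collapse w xs′))))))
      Unique-linExts

-- The identity holds for n = 0 as well.
theorem2p1 : (n : ℕ) → 1 ≤ n → (k : ℕ) → Fcoeff n k ≡ Pcoeff n k
theorem2p1 n _ k = begin
  Fcoeff n k
    ≡⟨ cong sum (map-cong (countᵇ-Lset k) (labelings n)) ⟩
  sum (map (λ w → countᵇ q (map (λ xs → encode (w , xs)) (linExts n))) (labelings n))
    ≡⟨ sum-countᵇ-concatMap q _ (labelings n) ⟩
  countᵇ q (concatMap (λ w → map (λ xs → encode (w , xs)) (linExts n)) (labelings n))
    ≡⟨ cong (countᵇ q) (concatMap-map≡map-cartesianProduct encode (labelings n) (linExts n)) ⟩
  countᵇ q Encodings
    ≡⟨ countᵇ-↭ q Encodings↭Pset ⟩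
  Pcoeff n k
    ∎
  where
  open ≡-Reasoning
  open Forest n
  q : List ℤ → Bool
  q σ = desB σ ℕ.≡ᵇ k
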